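{- Let $q\geq 5$ be an odd prime power, let $\sigma$ be a permutation of $\mathbb{F}_q$ whose graph contains exactly $(q-1)/2$ collinear triples, and let $\Omega=\{[x:\sigma(x):1]:x\in\mathbb{F}_q\}\cup\{[1:0:0],[0:1:0]\}\subseteq PG(2,q)$. Write $\Omega=C\cup\{P\}$ where $C$ is the zero set in $PG(2,q)$ of an irreducible homogeneous quadratic $ax^2+by^2+cxy+dxz+eyz+fz^2$ and $P\notin C$ (the external point). Let $\Gamma'=\{(x,y)\in\mathbb{F}_q^2:[x:y:1]\in C\}$. Then $a=b=0$, i.e. $\Gamma'=\{(x,y): cxy+dx+ey+f=0\}$.
   Context: A collinear triple in a permutation $\sigma$ of $\mathbb{F}_q$ is a set of three distinct points of its graph $\{(x,\sigma(x))\}$ lying on a common line of the affine plane $\mathbb{F}_q^2$. It is known (and assumed here) that such an $\Omega$ is the union of the points of an irreducible conic and one external point not on it; for $q\ge5$ this decomposition is unique. -}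

module Defs where

open import Level using (0ℓ)
open import Data.Nat using (ℕ)
open import Data.Fin using (Fin)
open import Data.Fin.Properties using (_≟_)
open import Data.List using (List; length; filter; allFin; concatMap; map)
open import Data.Product using (Σ; ∃; ∃-syntax; _×_; _,_)
open import Data.Sum using (_⊎_)
open import Data.Fin using (_<_)
open import Data.Fin.Properties using (_<?_)
open import Function.Bundles using (_↔_; Inverse)
open import Relation.Nullary using (¬_; Dec; yes; no; _×-dec_)
open import Relation.Binary.PropositionalEquality using (_≡_; refl; sym; trans; cong)
open import Algebra.Structures using (IsCommutativeRing)

record FiniteField (q : ℕ) : Set₁ where
  field
    Carrier : Set
    _+_ _*_ : Carrier → Carrier → Carrier
    -_      : Carrier → Carrier
    0# 1#   : Carrier
    isCommutativeRing : IsCommutativeRing _≡_ _+_ _*_ -_ 0# 1#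
    1≢0     : ¬ (1# ≡ 0#)
    inverse : ∀ x → ¬ (x ≡ 0#) → ∃[ y ] (x * y ≡ 1#)
    enum    : Fin q ↔ Carrier

  infixl 6 _+_ _-_
  infixl 7 _*_

  _-_ : Carrier → Carrier → Carrier
  x - y = x + (- y)

  elt : Fin q → Carrier
  elt = Inverse.to enum

  idx : Carrier → Fin q
  idx = Inverse.from enum

  Point2 : Set
  Point2 = Carrier × Carrier

  Collinear : Point2 → Point2 → Point2 → Set
  Collinear (x₁ , y₁) (x₂ , y₂) (x₃ , y₃) =
    (x₂ - x₁) * (y₃ - y₁) ≡ (y₂ - y₁) * (x₃ - x₁)

  infix 4 _≟F_
  _≟F_ : (x y : Carrier) → Dec (x ≡ y)
  x ≟F y with idx x ≟ idx y
  ... | yes e = yes (trans (sym (Inverse.strictlyInverseˡ enum x))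
                     (trans (cong elt e) (Inverse.strictlyInverseˡ enum y)))
  ... | no ne = no (λ e → ne (cong idx e))

  -- Number of collinear triples in the graph of σ: unordered sets
  -- {(x,σx),(y,σy),(z,σz)} of three distinct graph points (i.e. three
  -- distinct x's) lying on a common affine line.  Each such set is counted
  -- once, via its enumeration indices i < j < k.
  graphPt : (Carrier → Carrier) → Fin q → Point2
  graphPt σ i = (elt i , σ (elt i))

  Triple : Set
  Triple = Fin q × Fin q × Fin q

  allTriples : List Triple
  allTriples = concatMap (λ i → concatMap (λ j → map (λ k → (i , j , k)) (allFin q)) (allFin q)) (allFin q)

  IsCollinearTriple : (Carrier → Carrier) → Triple → Set
  IsCollinearTriple σ (i , j , k) =
    (i < j) × (j < k) × Collinear (graphPt σ i) (graphPt σ j) (graphPt σ k)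

  isCollinearTriple? : (σ : Carrier → Carrier) → (t : Triple) → Dec (IsCollinearTriple σ t)
  isCollinearTriple? σ (i , j , k) =
    (i <? j) ×-dec (j <? k) ×-dec
    (((elt j - elt i) * (σ (elt k) - σ (elt i))) ≟F ((σ (elt j) - σ (elt i)) * (elt k - elt i)))

  collinearTriples : (Carrier → Carrier) → ℕ
  collinearTriples σ = length (filter (isCollinearTriple? σ) allTriples)

  -- Homogeneous coordinates for PG(2,q): nonzero vectors of F_q^3,
  -- a projective point being the class of a vector up to nonzero scalars.
  Vec3 : Set
  Vec3 = Carrier × Carrier × Carrier

  NonZero3 : Vec3 → Set
  NonZero3 v = ¬ (v ≡ (0# , 0# , 0#))

  _·_ : Carrier → Vec3 → Vec3
  λ′ · (X , Y , Z) = (λ′ * X , λ′ * Y , λ′ * Z)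

  _∼_ : Vec3 → Vec3 → Set
  v ∼ w = ∃[ λ′ ] (¬ (λ′ ≡ 0#) × v ≡ λ′ · w)

  InΩ : (Carrier → Carrier) → Vec3 → Set
  InΩ σ v = (∃[ x ] (v ∼ (x , σ x , 1#))) ⊎ (v ∼ (1# , 0# , 0#)) ⊎ (v ∼ (0# , 1# , 0#))

  Coeffs : Set
  Coeffs = Carrier × Carrier × Carrier × Carrier × Carrier × Carrier

  evalQ : Coeffs → Vec3 → Carrier
  evalQ (a , b , c , d , e , f) (X , Y , Z) =
    a * X * X + b * Y * Y + c * X * Y + d * X * Z + e * Y * Z + f * Z * Z

  linProd : Vec3 → Vec3 → Coeffs
  linProd (l₁ , l₂ , l₃) (m₁ , m₂ , m₃) =
    ( l₁ * m₁ , l₂ * m₂ , l₁ * m₂ + l₂ * m₁ , l₁ * m₃ + l₃ * m₁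
    , l₂ * m₃ + l₃ * m₂ , l₃ * m₃ )

  -- Irreducible homogeneous quadratic over F_q: not a product of two
  -- linear forms over F_q (this also excludes the zero polynomial).
  IrreducibleQ : Coeffs → Set
  IrreducibleQ Q = ¬ (∃[ l ] ∃[ m ] (Q ≡ linProd l m))

-- [1:0:0] and [0:1:0] lie in Ω, so each lies on C, giving a = 0 resp. b = 0, unless it is
-- the external point P.  Exchanging x and y (and σ with σ⁻¹) swaps the two points, so it
-- suffices to rule out P = [1:0:0].  In that case b = 0, the line at infinity forces c = 0,
-- and every graph point satisfies a x² + d x + e σ(x) + f = 0 with a ≠ 0.  As q is odd,
-- x ↦ a x² + d x takes equal values at some x ≠ - x - d/a, so injectivity of σ forces e = 0
-- and then f = 0: C would be the line pair x (a x + d z) = 0, contradicting irreducibility.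
module Submission where

open import Defs
open import Data.Nat using (ℕ; zero; suc; _≤_; _^_; _/_; _%_; _∸_)
open import Data.Nat.Primality using (Prime)
open import Data.Fin using (Fin; zero; suc; punchIn; punchOut)
open import Data.Fin.Properties using (0≢1+n; suc-injective; punchIn-injective; punchInᵢ≢i; punchIn-punchOut)
open import Data.Product using (_×_; ∃-syntax; _,_; proj₁; proj₂)
open import Data.Sum using (_⊎_; inj₁; inj₂)
open import Data.Sum.Base using () renaming (map to ⊎-map)
open import Data.Empty using (⊥-elim)
open import Function.Base using (_∘_)
open import Function.Definitions using (Injective)
open import Function.Bundles using (_↔_; Inverse; _⇔_; Equivalence; mk⇔; Injection)
open import Function.Construct.Symmetry using (↔-sym)
open import Function.Properties.Inverse using (↔⇒↣)
open import Relation.Nullary using (¬_; yes; no)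
open import Algebra.Bundles using (CommutativeRing)
import Algebra.Properties.Ring as RingProperties
import Algebra.Properties.CommutativeSemigroup as CommutativeSemigroupProperties
open import Relation.Binary.PropositionalEquality

module DropPair {k : ℕ} (j : Fin (suc k)) where

  embed : Fin k → Fin (suc (suc k))
  embed i = suc (punchIn j i)

  embed-injective : ∀ {i i′} → embed i ≡ embed i′ → i ≡ i′
  embed-injective = punchIn-injective j _ _ ∘ suc-injective

  embed≢suc : ∀ i → embed i ≢ suc j
  embed≢suc i = punchInᵢ≢i j i ∘ suc-injective

  unembed : (w : Fin (suc (suc k))) → w ≢ zero → w ≢ suc j → Fin k
  unembed zero    w≢0 _   = ⊥-elim (w≢0 refl)
  unembed (suc y) _   w≢j = punchOut (w≢j ∘ cong suc ∘ sym)

  embed-unembed : ∀ w (w≢0 : w ≢ zero) (w≢j : w ≢ suc j) → embed (unembed w w≢0 w≢j) ≡ w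
  embed-unembed zero    w≢0 _ = ⊥-elim (w≢0 refl)
  embed-unembed (suc y) _   _ = cong suc (punchIn-punchOut _)

fixedPointFreeInvolution⇒even : ∀ n (g : Fin n → Fin n) →
  (∀ i → g (g i) ≡ i) → (∀ i → g i ≢ i) → n % 2 ≡ 0
fixedPointFreeInvolution⇒even zero          g involutive fpf = refl
fixedPointFreeInvolution⇒even (suc zero)    g involutive fpf with g zero in g0≡0
... | zero = ⊥-elim (fpf zero g0≡0)
fixedPointFreeInvolution⇒even (suc (suc k)) g involutive fpf with g zero in g0≡
... | zero  = ⊥-elim (fpf zero g0≡)
... | suc j = fixedPointFreeInvolution⇒even k h h-involutive h-fpf
  where
  open DropPair j

  gembed≢zero : ∀ i → g (embed i) ≢ zero
  gembed≢zero i eq = embed≢suc i (trans (sym (involutive (embed i))) (trans (cong g eq) g0≡))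

  gembed≢suc : ∀ i → g (embed i) ≢ suc j
  gembed≢suc i eq = 0≢1+n (sym (trans (sym (involutive (embed i)))
                                     (trans (cong g (trans eq (sym g0≡))) (involutive zero))))

  h : Fin k → Fin k
  h i = unembed (g (embed i)) (gembed≢zero i) (gembed≢suc i)

  embed-h : ∀ i → embed (h i) ≡ g (embed i)
  embed-h i = embed-unembed _ _ _

  h-involutive : ∀ i → h (h i) ≡ i
  h-involutive i = embed-injective (trans (embed-h (h i)) (trans (cong g (embed-h i)) (involutive (embed i))))

  h-fpf : ∀ i → h i ≢ i
  h-fpf i eq = fpf (embed i) (trans (sym (embed-h i)) (cong embed eq))

fixedPointFreeInvolution⇒even-↔ : ∀ {n} {A : Set} → Fin n ↔ A → (f : A → A) →
  (∀ x → f (f x) ≡ x) → (∀ x → f x ≢ x) → n % 2 ≡ 0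
fixedPointFreeInvolution⇒even-↔ {n} enum f involutive fpf =
  fixedPointFreeInvolution⇒even n g g-involutive g-fpf
  where
  open Inverse enum
  g : Fin n → Fin n
  g = from ∘ f ∘ to

  g-involutive : ∀ i → g (g i) ≡ i
  g-involutive i = begin
    from (f (to (from (f (to i))))) ≡⟨ cong (from ∘ f) (strictlyInverseˡ _) ⟩
    from (f (f (to i)))             ≡⟨ cong from (involutive (to i)) ⟩
    from (to i)                     ≡⟨ strictlyInverseʳ i ⟩
    i                               ∎
    where open ≡-Reasoning

  g-fpf : ∀ i → g i ≢ i
  g-fpf i eq = fpf (to i) (trans (sym (strictlyInverseˡ _)) (cong to eq))

module FiniteFieldProperties {q : ℕ} (F : FiniteField q) where
  open FiniteField F

  commutativeRing : CommutativeRing _ _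
  commutativeRing = record { isCommutativeRing = isCommutativeRing }

  open CommutativeRing commutativeRing public
    using ( ring; +-commutativeSemigroup; *-commutativeSemigroup; +-assoc; +-comm
          ; +-identityˡ; +-identityʳ; -‿inverseˡ; -‿inverseʳ
          ; *-assoc; *-comm; *-identityˡ; *-identityʳ; zeroˡ; zeroʳ; distribˡ )
  open RingProperties ring public
    using (+-cancelˡ; +-cancelʳ; -‿involutive; -0#≈0#; -‿+-comm; -‿distribˡ-*; -‿distribʳ-*)
  module +-Properties = CommutativeSemigroupProperties +-commutativeSemigroup
  module *-Properties = CommutativeSemigroupProperties *-commutativeSemigroup

  *-cancelˡ-≢0 : ∀ x {y z} → x ≢ 0# → x * y ≡ x * z → y ≡ z
  *-cancelˡ-≢0 x {y} {z} x≢0 xy≡xz with inverse x x≢0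
  ... | x⁻¹ , xx⁻¹≡1 = begin
    y               ≡⟨ sym (*-identityˡ y) ⟩
    1# * y          ≡⟨ cong (_* y) x⁻¹x≡1 ⟨
    x⁻¹ * x * y     ≡⟨ *-assoc x⁻¹ x y ⟩
    x⁻¹ * (x * y)   ≡⟨ cong (x⁻¹ *_) xy≡xz ⟩
    x⁻¹ * (x * z)   ≡⟨ *-assoc x⁻¹ x z ⟨
    x⁻¹ * x * z     ≡⟨ cong (_* z) x⁻¹x≡1 ⟩
    1# * z          ≡⟨ *-identityˡ z ⟩
    z               ∎
    where
    open ≡-Reasoning
    x⁻¹x≡1 : x⁻¹ * x ≡ 1#
    x⁻¹x≡1 = trans (*-comm x⁻¹ x) xx⁻¹≡1

  odd-order⇒1+1≢0 : q % 2 ≡ 1 → 1# + 1# ≢ 0#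
  odd-order⇒1+1≢0 odd 1+1≡0 with trans (sym odd) (fixedPointFreeInvolution⇒even-↔ enum (_+ 1#) +1-involutive +1-fpf)
    where
    +1-involutive : ∀ x → x + 1# + 1# ≡ x
    +1-involutive x = trans (+-assoc x 1# 1#) (trans (cong (x +_) 1+1≡0) (+-identityʳ x))

    +1-fpf : ∀ x → x + 1# ≢ x
    +1-fpf x x+1≡x = 1≢0 (+-cancelˡ x 1# 0# (trans x+1≡x (sym (+-identityʳ x))))
  ... | ()

  parabola-symmetric : ∀ {A D t} → A * t ≡ D → ∀ z →
    A * (- z - t) * (- z - t) + D * (- z - t) ≡ A * z * z + D * z
  parabola-symmetric {A} {t = t} refl z = begin
    A * w * w + A * t * w ≡⟨ factor w ⟩
    A * w * (w + t)       ≡⟨ cong (A * w *_) w+t≡-z ⟩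
    A * w * - z           ≡⟨ -‿distribʳ-* (A * w) z ⟨
    - (A * w * z)         ≡⟨ cong -_ (*-Properties.xy∙z≈xz∙y A w z) ⟩
    - (A * z * w)         ≡⟨ -‿distribʳ-* (A * z) w ⟩
    A * z * - w           ≡⟨ cong (A * z *_) -w≡z+t ⟩
    A * z * (z + t)       ≡⟨ factor z ⟨
    A * z * z + A * t * z ∎
    where
    open ≡-Reasoning
    w : Carrier
    w = - z - t

    factor : ∀ y → A * y * y + A * t * y ≡ A * y * (y + t)
    factor y = trans (cong (A * y * y +_) (*-Properties.xy∙z≈xz∙y A t y)) (sym (distribˡ (A * y) y t))

    w+t≡-z : w + t ≡ - z
    w+t≡-z = trans (+-assoc (- z) (- t) t) (trans (cong (- z +_) (-‿inverseˡ t)) (+-identityʳ (- z)))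

    -w≡z+t : - w ≡ z + t
    -w≡z+t = trans (cong -_ (-‿+-comm z t)) (-‿involutive (z + t))

  point-reflection≢id : 1# + 1# ≢ 0# → ∀ t → ¬ (∀ z → z ≡ - z - t)
  point-reflection≢id 1+1≢0 t fixes = 1+1≢0 (begin
    1# + 1#            ≡⟨ cong (1# +_) (fixes 1#) ⟩
    1# + (- 1# - t)    ≡⟨ +-assoc 1# (- 1#) (- t) ⟨
    1# + - 1# - t      ≡⟨ cong (_- t) (trans (-‿inverseʳ 1#) (sym -0#≈0#)) ⟩
    - 0# - t           ≡⟨ fixes 0# ⟨
    0#                 ∎)
    where open ≡-Reasoning

  injectiveGraph⊆parabola⇒degenerate : 1# + 1# ≢ 0# → ∀ {A D E G} {h : Carrier → Carrier} →
    A ≢ 0# → Injective _≡_ _≡_ h → (∀ x → A * x * x + D * x + E * h x + G ≡ 0#) →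
    E ≡ 0# × G ≡ 0#
  injectiveGraph⊆parabola⇒degenerate 1+1≢0 {A} {D} {E} {G} {h} A≢0 h-injective on-conic
    with E ≟F 0#
  ... | yes E≡0 = E≡0 , G≡0
    where
    open ≡-Reasoning
    G≡0 : G ≡ 0#
    G≡0 = begin
      G                                          ≡⟨ +-identityˡ G ⟨
      0# + G                                     ≡⟨ cong (_+ G) lower-terms≡0 ⟨
      A * 0# * 0# + D * 0# + E * h 0# + G        ≡⟨ on-conic 0# ⟩
      0#                                         ∎
      where
      lower-terms≡0 : A * 0# * 0# + D * 0# + E * h 0# ≡ 0#
      lower-terms≡0 rewrite zeroʳ (A * 0#) | zeroʳ D | E≡0 | zeroˡ (h 0#)
                          | +-identityˡ 0# | +-identityˡ 0# = refl
  ... | no E≢0 with inverse A A≢0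
  -- S is invariant under the reflection z ↦ - z - t in the axis of the parabola, so
  -- injectivity of h would make that reflection the identity
  ... | A⁻¹ , AA⁻¹≡1 = ⊥-elim (point-reflection≢id 1+1≢0 t reflection-fixes)
    where
    t : Carrier
    t = D * A⁻¹
    At≡D : A * t ≡ D
    At≡D = trans (*-Properties.x∙yz≈y∙xz A D A⁻¹) (trans (cong (D *_) AA⁻¹≡1) (*-identityʳ D))

    S : Carrier → Carrier
    S x = A * x * x + D * x

    reflection-fixes : ∀ z → z ≡ - z - t
    reflection-fixes z = h-injective (*-cancelˡ-≢0 E E≢0 (+-cancelˡ (S z) _ _ (+-cancelʳ G _ _ (begin
      S z + E * h z + G                        ≡⟨ on-conic z ⟩
      0#                                       ≡⟨ on-conic (- z - t) ⟨
      S (- z - t) + E * h (- z - t) + G        ≡⟨ cong (λ s → s + E * h (- z - t) + G) (parabola-symmetric At≡D z) ⟩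
      S z + E * h (- z - t) + G                ∎))))
      where open ≡-Reasoning

module ProjectivePlane {q : ℕ} (F : FiniteField q) where
  open FiniteField F
  open FiniteFieldProperties F

  e₁ e₂ : Vec3
  e₁ = (1# , 0# , 0#)
  e₂ = (0# , 1# , 0#)

  swapXY : Vec3 → Vec3
  swapXY (X , Y , Z) = (Y , X , Z)

  swapXY-coeffs : Coeffs → Coeffs
  swapXY-coeffs (a , b , c , d , e , f) = (b , a , c , e , d , f)

  evalQ-swapXY : ∀ Q v → evalQ (swapXY-coeffs Q) (swapXY v) ≡ evalQ Q v
  evalQ-swapXY (a , b , c , d , e , f) (X , Y , Z) = begin
    b * Y * Y + a * X * X + c * Y * X + e * Y * Z + d * X * Z + f * Z * Z
      ≡⟨ cong (λ m → b * Y * Y + a * X * X + m + e * Y * Z + d * X * Z + f * Z * Z)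
              (*-Properties.xy∙z≈xz∙y c Y X) ⟩
    b * Y * Y + a * X * X + c * X * Y + e * Y * Z + d * X * Z + f * Z * Z
      ≡⟨ cong (_+ f * Z * Z) (+-Properties.xy∙z≈xz∙y _ (e * Y * Z) (d * X * Z)) ⟩
    b * Y * Y + a * X * X + c * X * Y + d * X * Z + e * Y * Z + f * Z * Z
      ≡⟨ cong (λ s → s + c * X * Y + d * X * Z + e * Y * Z + f * Z * Z) (+-comm (b * Y * Y) (a * X * X)) ⟩
    a * X * X + b * Y * Y + c * X * Y + d * X * Z + e * Y * Z + f * Z * Z ∎
    where open ≡-Reasoning

  linProd-swapXY : ∀ l m → swapXY-coeffs (linProd l m) ≡ linProd (swapXY l) (swapXY m)
  linProd-swapXY (l₁ , l₂ , l₃) (m₁ , m₂ , m₃) =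
    cong (λ c → (l₂ * m₂ , l₁ * m₁ , c , l₂ * m₃ + l₃ * m₂ , l₁ * m₃ + l₃ * m₁ , l₃ * m₃))
         (+-comm (l₁ * m₂) (l₂ * m₁))

  ∼-refl : ∀ {v} → v ∼ v
  ∼-refl {X , Y , Z} = 1# , 1≢0 , sym (cong₂ _,_ (*-identityˡ X) (cong₂ _,_ (*-identityˡ Y) (*-identityˡ Z)))

  ∼-swapXY : ∀ {v w} → v ∼ w → swapXY v ∼ swapXY w
  ∼-swapXY (λ′ , λ′≢0 , v≡λw) = λ′ , λ′≢0 , cong swapXY v≡λw

  InΩ-swapXY : ∀ (σ : Carrier ↔ Carrier) {v} → InΩ (Inverse.to σ) v → InΩ (Inverse.from σ) (swapXY v)
  InΩ-swapXY σ (inj₁ (x , v∼graph)) =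
    inj₁ (Inverse.to σ x , subst (λ y → swapXY _ ∼ (Inverse.to σ x , y , 1#))
                                 (sym (Inverse.strictlyInverseʳ σ x)) (∼-swapXY v∼graph))
  InΩ-swapXY σ (inj₂ (inj₁ v∼e₁)) = inj₂ (inj₂ (∼-swapXY v∼e₁))
  InΩ-swapXY σ (inj₂ (inj₂ v∼e₂)) = inj₂ (inj₁ (∼-swapXY v∼e₂))

  evalQ-x-axis : ∀ {a b c d e f X Y Z} → Y ≡ 0# → Z ≡ 0# →
    evalQ (a , b , c , d , e , f) (X , Y , Z) ≡ a * X * X
  evalQ-x-axis {a} {b} {c} {d} {e} {f} {X} refl refl
    rewrite zeroʳ (b * 0#) | zeroʳ (c * X) | zeroʳ (d * X) | zeroʳ (e * 0#) | zeroʳ (f * 0#)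
          | +-identityʳ (a * X * X) | +-identityʳ (a * X * X) | +-identityʳ (a * X * X)
          | +-identityʳ (a * X * X) | +-identityʳ (a * X * X) = refl

  evalQ-e₁ : ∀ {a b c d e f} → evalQ (a , b , c , d , e , f) e₁ ≡ a
  evalQ-e₁ {a} = trans (evalQ-x-axis refl refl) (trans (*-identityʳ (a * 1#)) (*-identityʳ a))

  evalQ-e₂ : ∀ {a b c d e f} → evalQ (a , b , c , d , e , f) e₂ ≡ b
  evalQ-e₂ {a} {b} {c} {d} {e} {f} = trans (evalQ-swapXY (b , a , c , e , d , f) e₁) evalQ-e₁

  evalQ-affine : ∀ {a b c d e f X Y} → b ≡ 0# → c ≡ 0# →
    evalQ (a , b , c , d , e , f) (X , Y , 1#) ≡ a * X * X + d * X + e * Y + f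
  evalQ-affine {a} {d = d} {e} {f} {X} {Y} refl refl
    rewrite zeroˡ Y | zeroˡ Y | zeroˡ X | zeroˡ Y | +-identityʳ (a * X * X) | +-identityʳ (a * X * X)
          | *-identityʳ (d * X) | *-identityʳ (e * Y) | *-identityʳ (f * 1#) | *-identityʳ f = refl

  evalQ-[-c:a:0] : ∀ {a b c d e f} → b ≡ 0# → evalQ (a , b , c , d , e , f) (- c , a , 0#) ≡ 0#
  evalQ-[-c:a:0] {a} {c = c} {d} {e} {f} refl
    rewrite zeroˡ a | zeroˡ a | zeroʳ (d * - c) | zeroʳ (e * a) | zeroʳ (f * 0#)
          | +-identityʳ (a * - c * - c) | +-identityʳ (a * - c * - c + c * - c * a)
          | +-identityʳ (a * - c * - c + c * - c * a) | +-identityʳ (a * - c * - c + c * - c * a) = begin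
    a * - c * - c + c * - c * a     ≡⟨ cong₂ _+_ (cong (_* - c) (-‿distribʳ-* a c)) (*-comm a (c * - c)) ⟨
    - (a * c) * - c + a * (c * - c) ≡⟨ cong₂ _+_ (-‿distribˡ-* (a * c) (- c)) (*-assoc a c (- c)) ⟨
    - (a * c * - c) + a * c * - c   ≡⟨ -‿inverseˡ (a * c * - c) ⟩
    0#                              ∎
    where open ≡-Reasoning

  Q≡x·[ax+dz] : ∀ {a b c d e f} → b ≡ 0# → c ≡ 0# → e ≡ 0# → f ≡ 0# →
    (a , b , c , d , e , f) ≡ linProd (1# , 0# , 0#) (a , 0# , d)
  Q≡x·[ax+dz] {a} {d = d} refl refl refl refl = cong₂ _,_ (sym (*-identityˡ a)) (cong₂ _,_ (sym (zeroˡ 0#)) (cong₂ _,_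
    (sym (trans (cong₂ _+_ (zeroʳ 1#) (zeroˡ a)) (+-identityˡ 0#))) (cong₂ _,_
    (sym (trans (cong₂ _+_ (*-identityˡ d) (zeroˡ a)) (+-identityʳ d))) (cong₂ _,_
    (sym (trans (cong₂ _+_ (zeroˡ d) (zeroˡ 0#)) (+-identityˡ 0#))) (sym (zeroˡ d))))))

  record ConicPlusPoint (σ : Carrier ↔ Carrier) (Q : Coeffs) (P : Vec3) : Set where
    field
      irreducible : IrreducibleQ Q
      P∉C         : evalQ Q P ≢ 0#
      Ω⇔C∪P       : ∀ v → NonZero3 v → InΩ (Inverse.to σ) v ⇔ (evalQ Q v ≡ 0# ⊎ v ∼ P)

    Ω⊆C∪P : ∀ {v} → NonZero3 v → InΩ (Inverse.to σ) v → evalQ Q v ≡ 0# ⊎ v ∼ P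
    Ω⊆C∪P {v} v≢0 = Equivalence.to (Ω⇔C∪P v v≢0)

    C⊆Ω : ∀ {v} → NonZero3 v → evalQ Q v ≡ 0# → InΩ (Inverse.to σ) v
    C⊆Ω {v} v≢0 = Equivalence.from (Ω⇔C∪P v v≢0) ∘ inj₁

  swapXY-ConicPlusPoint : ∀ {σ Q P} → ConicPlusPoint σ Q P →
    ConicPlusPoint (↔-sym σ) (swapXY-coeffs Q) (swapXY P)
  swapXY-ConicPlusPoint {σ} {Q} {P} C∪P = record
    { irreducible = λ (l , m , Q′≡lm) →
        irreducible (swapXY l , swapXY m , trans (cong swapXY-coeffs Q′≡lm) (linProd-swapXY l m))
    ; P∉C         = P∉C ∘ trans (sym (evalQ-swapXY Q P))
    ; Ω⇔C∪P       = Ω⇔C∪P′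
    }
    where
    open ConicPlusPoint C∪P
    Ω⇔C∪P′ : ∀ v → NonZero3 v →
      InΩ (Inverse.from σ) v ⇔ (evalQ (swapXY-coeffs Q) v ≡ 0# ⊎ v ∼ swapXY P)
    Ω⇔C∪P′ v v≢0 = mk⇔
      (⊎-map (trans (evalQ-swapXY Q w)) ∼-swapXY ∘ Ω⊆C∪P w≢0 ∘ InΩ-swapXY (↔-sym σ))
      (InΩ-swapXY σ ∘ Equivalence.from (Ω⇔C∪P w w≢0) ∘ ⊎-map (trans (sym (evalQ-swapXY Q w))) ∼-swapXY)
      where
      w : Vec3
      w = swapXY v
      w≢0 : NonZero3 w
      w≢0 = v≢0 ∘ cong swapXY

  module _ (1+1≢0 : 1# + 1# ≢ 0#) {σ : Carrier ↔ Carrier} {a b c d e f P₁ P₂ P₃ : Carrier}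
           (C∪P : ConicPlusPoint σ (a , b , c , d , e , f) (P₁ , P₂ , P₃)) where
    open ConicPlusPoint C∪P

    private
      1≢μ*0 : ∀ μ → 1# ≢ μ * 0#
      1≢μ*0 μ 1≡μ0 = 1≢0 (trans 1≡μ0 (zeroʳ μ))

      e₁∈Ω : InΩ (Inverse.to σ) e₁
      e₁∈Ω = inj₂ (inj₁ ∼-refl)

      e₂∈Ω : InΩ (Inverse.to σ) e₂
      e₂∈Ω = inj₂ (inj₂ ∼-refl)

      graph⊆Ω : ∀ x → InΩ (Inverse.to σ) (x , Inverse.to σ x , 1#)
      graph⊆Ω x = inj₁ (x , ∼-refl)

    e₁≁P : ¬ e₁ ∼ (P₁ , P₂ , P₃)
    e₁≁P (λ′ , λ′≢0 , e₁≡λP) = irreducible (_ , _ , Q≡x·[ax+dz] b≡0 c≡0 e≡0 f≡0)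
      where
      s : Carrier → Carrier
      s = Inverse.to σ

      P₂≡0 : P₂ ≡ 0#
      P₂≡0 = *-cancelˡ-≢0 λ′ λ′≢0 (trans (sym (cong (proj₁ ∘ proj₂) e₁≡λP)) (sym (zeroʳ λ′)))

      P₃≡0 : P₃ ≡ 0#
      P₃≡0 = *-cancelˡ-≢0 λ′ λ′≢0 (trans (sym (cong (proj₂ ∘ proj₂) e₁≡λP)) (sym (zeroʳ λ′)))

      a≢0 : a ≢ 0#
      a≢0 refl = P∉C (trans (evalQ-x-axis P₂≡0 P₃≡0) (trans (cong (_* P₁) (zeroˡ P₁)) (zeroˡ P₁)))

      b≡0 : b ≡ 0#
      b≡0 with Ω⊆C∪P (1≢0 ∘ cong (proj₁ ∘ proj₂)) e₂∈Ω
      ... | inj₁ Qe₂≡0           = trans (sym evalQ-e₂) Qe₂≡0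
      ... | inj₂ (μ , _ , e₂≡μP) = ⊥-elim (1≢μ*0 μ (trans (cong (proj₁ ∘ proj₂) e₂≡μP) (cong (μ *_) P₂≡0)))

      -- the line at infinity meets C in [0:1:0] and [-c:a:0], and only [0:1:0] lies in Ω
      c≡0 : c ≡ 0#
      c≡0 with C⊆Ω (a≢0 ∘ cong (proj₁ ∘ proj₂)) (evalQ-[-c:a:0] b≡0)
      ... | inj₁ (_ , μ , μ≢0 , v≡μg)  = ⊥-elim (μ≢0 (sym (trans (cong (proj₂ ∘ proj₂) v≡μg) (*-identityʳ μ))))
      ... | inj₂ (inj₁ (μ , _ , v≡μe₁)) = ⊥-elim (a≢0 (trans (cong (proj₁ ∘ proj₂) v≡μe₁) (zeroʳ μ)))
      ... | inj₂ (inj₂ (μ , _ , v≡μe₂)) = begin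
        c       ≡⟨ -‿involutive c ⟨
        - (- c) ≡⟨ cong -_ (trans (cong proj₁ v≡μe₂) (zeroʳ μ)) ⟩
        - 0#    ≡⟨ -0#≈0# ⟩
        0#      ∎
        where open ≡-Reasoning

      graph⊆parabola : ∀ x → a * x * x + d * x + e * s x + f ≡ 0#
      graph⊆parabola x with Ω⊆C∪P (1≢0 ∘ cong (proj₂ ∘ proj₂)) (graph⊆Ω x)
      ... | inj₁ Q≡0            = trans (sym (evalQ-affine b≡0 c≡0)) Q≡0
      ... | inj₂ (μ , _ , g≡μP) = ⊥-elim (1≢μ*0 μ (trans (cong (proj₂ ∘ proj₂) g≡μP) (cong (μ *_) P₃≡0)))

      e≡0×f≡0 : e ≡ 0# × f ≡ 0#
      e≡0×f≡0 = injectiveGraph⊆parabola⇒degenerate 1+1≢0 a≢0 (Injection.injective (↔⇒↣ σ)) graph⊆parabola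

      e≡0 : e ≡ 0#
      e≡0 = proj₁ e≡0×f≡0

      f≡0 : f ≡ 0#
      f≡0 = proj₂ e≡0×f≡0

    x²-coefficient≡0 : a ≡ 0#
    x²-coefficient≡0 with Ω⊆C∪P (1≢0 ∘ cong proj₁) e₁∈Ω
    ... | inj₁ Qe₁≡0  = trans (sym evalQ-e₁) Qe₁≡0
    ... | inj₂ e₁∼P   = ⊥-elim (e₁≁P e₁∼P)

mainTheorem4 : (q : ℕ) → (∃[ p ] ∃[ k ] (Prime p × q ≡ p ^ k)) → q % 2 ≡ 1 → 5 ≤ q →
    (F : FiniteField q) → let open FiniteField F in
    (σ : Carrier ↔ Carrier) →
    collinearTriples (Inverse.to σ) ≡ (q ∸ 1) / 2 →
    (a b c d e f : Carrier) → (P : Vec3) →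
    IrreducibleQ (a , b , c , d , e , f) →
    NonZero3 P →
    ¬ (evalQ (a , b , c , d , e , f) P ≡ 0#) →
    (∀ v → NonZero3 v →
      InΩ (Inverse.to σ) v ⇔ (evalQ (a , b , c , d , e , f) v ≡ 0# ⊎ v ∼ P)) →
    (a ≡ 0#) × (b ≡ 0#)
mainTheorem4 q _ q-odd _ F σ _ a b c d e f P irreducible _ P∉C Ω⇔C∪P =
  x²-coefficient≡0 1+1≢0 C∪P , x²-coefficient≡0 1+1≢0 (swapXY-ConicPlusPoint C∪P)
  where
  open FiniteField F using (_+_; 0#; 1#)
  open ProjectivePlane F
  1+1≢0 : 1# + 1# ≢ 0#
  1+1≢0 = FiniteFieldProperties.odd-order⇒1+1≢0 F q-odd
  C∪P : ConicPlusPoint σ (a , b , c , d , e , f) P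
  C∪P = record { irreducible = irreducible ; P∉C = P∉C ; Ω⇔C∪P = Ω⇔C∪P }
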